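{- Let $G$ be a $5$-odd-connected graph, let $v$ be a vertex of degree eight and let $v_1,\ldots,v_8$ be its neighbors. Suppose that $G.v_1vv_2$ is $5$-odd-connected. Then at least one of the following graphs is also $5$-odd-connected: $G.v_1vv_2.v_3vv_4$, $G.v_1vv_2.v_7vv_8$, $G.v_1vv_2.v_3vv_8.v_4vv_5$ and $G.v_1vv_2.v_3vv_8.v_4vv_6$.
   Context: Graphs may have loops and parallel edges. For a partition $(A,B)$ of the vertex set, the edge-cut $E(A,B)$ is the set of edges with one end in $A$ and the other in $B$. A graph is $5$-odd-connected if it has no edge-cut of odd size less than $5$. Splitting: for a vertex $v$ and neighbors $v_1,v_2$ of $v$, the graph $G.v_1vv_2$ is obtained by removing the edges $vv_1$ and $vv_2$ and adding a new vertex joined by one edge to $v_1$ and one edge to $v_2$ (with the natural conventions for loops). Iterated splittings such as $G.v_1vv_2.v_3vv_4$ mean that the splitting $.v_3vv_4$ is applied to the graph $G.v_1vv_2$ (the remaining edges $vv_3,vv_4,\dots$ are unchanged by the earlier splittings). -}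

module Defs where

open import Data.Nat using (ℕ; zero; suc; _+_; _*_; _≤_)
open import Data.Bool using (Bool; true; false; if_then_else_; _xor_; _∨_)
open import Data.Fin using (Fin; inject₁; fromℕ)
open import Data.Fin.Properties using () renaming (_≟_ to _≟F_)
open import Data.Bool.Properties using () renaming (_≟_ to _≟B_)
open import Data.Product using (_×_; _,_; proj₁; proj₂; ∃)
open import Data.Product.Properties using (≡-dec)
open import Data.List using (List; map; allFin)
open import Data.Nat.ListAction using (sum)
open import Relation.Nullary.Decidable using (⌊_⌋; Dec)
open import Relation.Binary.PropositionalEquality using (_≡_)

-- A finite multigraph (loops and parallel edges allowed) with vertex set
-- Fin n and edge set Fin m; edge e has ends (end G (e , false)) and
-- (end G (e , true)).
Graph : ℕ → ℕ → Set
Graph n m = Fin m → Fin n × Fin n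

-- A dart (half-edge): an edge together with a choice of one of its two ends.
Dart : ℕ → Set
Dart m = Fin m × Bool

end : ∀ {n m} → Graph n m → Dart m → Fin n
end G (e , false) = proj₁ (G e)
end G (e , true)  = proj₂ (G e)

_≟D_ : ∀ {m} (x y : Dart m) → Dec (x ≡ y)
_≟D_ = ≡-dec _≟F_ _≟B_

-- Splitting G.v₁vv₂: the darts a and b (both at v, with other ends v₁, v₂)
-- are detached from v and attached to a new vertex (fromℕ n).  This removes
-- the edges vv₁, vv₂ and adds a new vertex joined by one edge to v₁ and one
-- edge to v₂.  Old vertices u are renamed inject₁ u; edge names are kept,
-- so darts of G remain darts of the split graph.
split : ∀ {n m} → Graph n m → Dart m → Dart m → Graph (suc n) m
split {n} G a b e = f (e , false) , f (e , true)
  where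
  f : _ → Fin (suc n)
  f d = if ⌊ d ≟D a ⌋ ∨ ⌊ d ≟D b ⌋ then fromℕ n else inject₁ (end G d)

cutSize : ∀ {n m} → Graph n m → (Fin n → Bool) → ℕ
cutSize {n} {m} G S =
  sum (map (λ e → if S (end G (e , false)) xor S (end G (e , true)) then 1 else 0)
           (allFin m))

Odd : ℕ → Set
Odd k = ∃ λ j → k ≡ suc (2 * j)

FiveOddConnected : ∀ {n m} → Graph n m → Set
FiveOddConnected G = ∀ S → Odd (cutSize G S) → 5 ≤ cutSize G S

module Submission where

-- A vertex set X is tight at z if z ∈ X and |δ(X)| = 5; a dart at z leaves X if its far end lies
-- outside X.  Three facts about a 5-odd-connected graph G and a vertex z whose darts are listed by
-- a Star drive the proof:
--   * obstruction: if splitting off the darts a, b at z destroys 5-odd-connectivity, then some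
--     tight set at z is left by both a and b;
--   * uncross: two tight sets at z left by a common dart at z meet in a tight set (submodularity,
--     posimodularity and a parity count of the cut function);
--   * too-many-exits: if z has even degree k, no tight set at z is left by more than k/2 darts.
-- The first and last follow from the vertex-deletion identity
-- |δ(X − z)| + 2·#(darts at z leaving X) = |δ(X)| + |δ({z})|.
-- In H = G.v₁vv₂ the vertex v has degree six.  If H.v₃vv₄ and H.v₇vv₈ both fail, then
-- K = H.v₃vv₈ is 5-odd-connected, for otherwise three obstructions meet in a tight set left by
-- four of the six darts.  In K, v has degree four, and obstructions for K.v₄vv₅ and K.v₄vv₆ would
-- meet in a tight set left by three of the four darts.
-- Cut sizes are handled as sums over edges of 0/1 indicators, so that every identity and
-- inequality between cuts is a sum of edgewise facts about truth values.

open import Defs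
open import Data.Nat using (ℕ)
open import Data.Fin using (Fin)
open import Data.Fin.Patterns using (0F; 1F; 2F; 3F; 4F; 5F; 6F; 7F)
open import Data.Product using (Σ; ∃; _,_)
open import Data.Sum using (_⊎_)
open import Function.Definitions using (Injective)
open import Relation.Binary.PropositionalEquality using (_≡_)

open import Algebra.Bundles using (CommutativeRing)
open import Data.Bool using (Bool; true; false; not; _∧_; _∨_; _xor_; if_then_else_; T; b≤b)
  renaming (_≤_ to _≤ᴮ_)
open import Data.Bool.Properties
  using ( T-∧; not-involutive; ∧-zeroʳ; ∨-zeroʳ; ∨-identityʳ; xor-identityʳ; xor-annihilates-not
        ; xor-∧-commutativeRing; ≤-minimum)
open import Data.Empty using (⊥; ⊥-elim)
open import Data.Fin using (inject₁; fromℕ; _↑ʳ_) renaming (zero to fzero; suc to fsuc)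
open import Data.Fin.Properties using (_≟_; inject₁-injective; fromℕ≢inject₁; ↑ʳ-injective; suc-injective)
open import Data.Fin.Subset.Properties using (anySubset?)
import Data.List as List
open import Data.List.Properties using (map-tabulate)
open import Data.Nat using (zero; suc; _+_; _*_; _≤_; _<_; _≤ᵇ_; z≤n; parity; _<?_)
open import Data.Nat.ListAction using () renaming (sum to listSum)
open import Data.Nat.Properties
  using ( +-*-semiring; +-identityʳ; +-suc; +-mono-≤; +-monoˡ-≤; +-monoʳ-≤; *-monoʳ-≤; +-cancelˡ-≤; +-cancelʳ-≤
        ; ≤-refl; ≤-reflexive; ≤-trans; ≤-antisym; ≤-pred; m≤m+n; m≤n+m; m≤n⇒m<n∨m≡n
        ; ≮⇒≥; <⇒≱; ≤ᵇ⇒≤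
        ; module ≤-Reasoning)
open import Data.Parity using (0ℙ; 1ℙ) renaming (_+_ to _+ₚ_)
open import Data.Parity.Properties using (+-homo-+; *-homo-*) renaming (_≟_ to _≟ₚ_; +-identityʳ to +ₚ-identityʳ)
open import Data.Product using (proj₁; proj₂; _×_)
open import Data.Sum using (inj₁; inj₂; [_,_]′)
open import Data.Vec using (lookup; tabulate)
open import Data.Vec.Properties using (lookup∘tabulate)
open import Function using (_∘_; _$_; id)
open import Function.Bundles using (Equivalence)
open import Relation.Binary.PropositionalEquality
  using (_≢_; refl; sym; trans; cong; cong₂; subst; module ≡-Reasoning)
open import Relation.Nullary using (Dec; yes; no; ¬_)
open import Relation.Nullary.Decidable using (⌊_⌋; map′; _×-dec_; dec-true; dec-false; isYes≗does)

open import Algebra.Properties.CommutativeSemigroup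
  (CommutativeRing.+-commutativeSemigroup xor-∧-commutativeRing) using (interchange)
open import Algebra.Properties.Semiring.Sum +-*-semiring
  using (sum-syntax; ∑-distrib-+; ∑-comm; sum-cong-≗; *-distribˡ-sum; sum-replicate-zero)

∑-zero : ∀ {k} {f : Fin k → ℕ} → (∀ i → f i ≡ 0) → ∑[ i < k ] f i ≡ 0
∑-zero {k} f≡0 = trans (sum-cong-≗ f≡0) (sum-replicate-zero k)

∑-mono : ∀ {k} {f g : Fin k → ℕ} → (∀ i → f i ≤ g i) → ∑[ i < k ] f i ≤ ∑[ i < k ] g i
∑-mono {zero}  _   = z≤n
∑-mono {suc k} f≤g = +-mono-≤ (f≤g fzero) (∑-mono (f≤g ∘ fsuc))

term-≤-∑ : ∀ {k} (f : Fin k → ℕ) i → f i ≤ ∑[ j < k ] f j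
term-≤-∑ f fzero    = m≤m+n _ _
term-≤-∑ f (fsuc i) = ≤-trans (term-≤-∑ (f ∘ fsuc) i) (m≤n+m _ _)

∑-point : ∀ {k} (f : Fin k → ℕ) j → (∀ i → i ≢ j → f i ≡ 0) → ∑[ i < k ] f i ≡ f j
∑-point f fzero    off = trans (cong (f fzero +_) (∑-zero (λ i → off (fsuc i) λ ()))) (+-identityʳ _)
∑-point {suc k} f (fsuc j) off =
  trans (cong (_+ ∑[ i < k ] f (fsuc i)) (off fzero λ ()))
        (∑-point (f ∘ fsuc) j (λ i i≢j → off (fsuc i) (i≢j ∘ suc-injective)))

∑-double : ∀ {k} {f g h : Fin k → ℕ} → (∀ i → f i + 2 * g i ≡ h i)
         → ∑[ i < k ] f i + 2 * ∑[ i < k ] g i ≡ ∑[ i < k ] h i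
∑-double {k} {f} {g} {h} eq = begin
  ∑[ i < k ] f i + 2 * ∑[ i < k ] g i          ≡⟨ cong (∑[ i < k ] f i +_) (*-distribˡ-sum 2 g) ⟩
  ∑[ i < k ] f i + ∑[ i < k ] (2 * g i)        ≡⟨ sym (∑-distrib-+ f (λ i → 2 * g i)) ⟩
  ∑[ i < k ] (f i + 2 * g i)                   ≡⟨ sum-cong-≗ eq ⟩
  ∑[ i < k ] h i                               ∎
  where open ≡-Reasoning

∑-ones : ∀ k → ∑[ i < k ] 1 ≡ k
∑-ones zero    = refl
∑-ones (suc k) = cong suc (∑-ones k)

parity-2* : ∀ b → parity (2 * b) ≡ 0ℙ
parity-2* b = *-homo-* 2 b

parity-+2* : ∀ a b → parity (a + 2 * b) ≡ parity a
parity-+2* a b = trans (+-homo-+ a (2 * b)) (trans (cong (parity a +ₚ_) (parity-2* b)) (+ₚ-identityʳ (parity a)))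

∑-parity : ∀ {k} {f g : Fin k → ℕ} → (∀ i → parity (f i) ≡ parity (g i))
         → parity (∑[ i < k ] f i) ≡ parity (∑[ i < k ] g i)
∑-parity {zero}  _  = refl
∑-parity {suc k} {f} {g} eq = begin
  parity (f fzero + ∑[ i < k ] f (fsuc i))                 ≡⟨ +-homo-+ (f fzero) _ ⟩
  parity (f fzero) +ₚ parity (∑[ i < k ] f (fsuc i))       ≡⟨ cong₂ _+ₚ_ (eq fzero) (∑-parity (eq ∘ fsuc)) ⟩
  parity (g fzero) +ₚ parity (∑[ i < k ] g (fsuc i))       ≡⟨ +-homo-+ (g fzero) _ ⟨
  parity (g fzero + ∑[ i < k ] g (fsuc i))                 ∎
  where open ≡-Reasoning

Odd⇒parity : ∀ {c} → Odd c → parity c ≡ 1ℙ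
Odd⇒parity (j , refl) = trans (+-homo-+ 1 (2 * j)) (cong (1ℙ +ₚ_) (parity-2* j))

parity⇒Odd : ∀ {c} → parity c ≡ 1ℙ → Odd c
parity⇒Odd {1}           _   = 0 , refl
parity⇒Odd {suc (suc c)} odd with parity⇒Odd {c} odd
... | j , refl = suc j , cong (suc ∘ suc) (sym (+-suc j (j + 0)))

odd? : ∀ c → Dec (Odd c)
odd? c = map′ parity⇒Odd Odd⇒parity (parity c ≟ₚ 1ℙ)

odd-below-5 : ∀ {c} → parity c ≡ 1ℙ → c < 5 → c ≤ 3
odd-below-5 odd c<5 with m≤n⇒m<n∨m≡n (≤-pred c<5)
... | inj₁ c<4 = ≤-pred c<4
odd-below-5 () _ | inj₂ refl

FiveIfOdd : ℕ → Set
FiveIfOdd c = parity c ≡ 1ℙ → 5 ≤ c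

⟦_⟧ : Bool → ℕ
⟦ b ⟧ = if b then 1 else 0

⟦⟧-mono : ∀ {b c} → (T b → T c) → ⟦ b ⟧ ≤ ⟦ c ⟧
⟦⟧-mono {false}         _ = z≤n
⟦⟧-mono {true} {true}  _ = ≤-refl
⟦⟧-mono {true} {false} h = ⊥-elim (h _)

⟦⟧-parity : ∀ u w → parity (⟦ u ⟧ + ⟦ w ⟧) ≡ parity ⟦ u xor w ⟧
⟦⟧-parity false w     = refl
⟦⟧-parity true  false = refl
⟦⟧-parity true  true  = refl

-- Two indicators summing to 2 are both true (the shape is that of a sum over Fin 2).
both-true : ∀ {p q} → ⟦ p ⟧ + (⟦ q ⟧ + 0) ≡ 2 → p ≡ true × q ≡ true
both-true {true} {true} _ = refl , refl
both-true {false} {false} ()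
both-true {false} {true} ()
both-true {true} {false} ()

⌊⌋-yes : ∀ {A : Set} (a? : Dec A) → A → ⌊ a? ⌋ ≡ true
⌊⌋-yes a? a = trans (isYes≗does a?) (dec-true a? a)

⌊⌋-no : ∀ {A : Set} (a? : Dec A) → ¬ A → ⌊ a? ⌋ ≡ false
⌊⌋-no a? ¬a = trans (isYes≗does a?) (dec-false a? ¬a)

every : (Bool → Bool) → Bool
every p = p false ∧ p true

every-sound : ∀ p → T (every p) → ∀ b → T (p b)
every-sound p h false = proj₁ (Equivalence.to T-∧ h)
every-sound p h true  = proj₂ (Equivalence.to T-∧ h)

≤-by-truth-table : (f g : Bool → Bool → Bool → Bool → ℕ)
  → T (every λ a → every λ b → every λ c → every λ d → f a b c d ≤ᵇ g a b c d)
  → ∀ a b c d → f a b c d ≤ g a b c d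
≤-by-truth-table f g table a b c d =
  ≤ᵇ⇒≤ _ _ (every-sound (P a b c) (every-sound (every ∘ P a b) (every-sound (every ∘ (λ b c → every (P a b c)))
    (every-sound (λ a → every λ b → every λ c → every (P a b c)) table a) b) c) d)
  where
  P : Bool → Bool → Bool → Bool → Bool
  P a b c d = f a b c d ≤ᵇ g a b c d

VertexSet : ℕ → Set
VertexSet n = Fin n → Bool

module _ {n : ℕ} where

  _∩_ _∪_ _─_ _△_ : VertexSet n → VertexSet n → VertexSet n
  (A ∩ B) u = A u ∧ B u
  (A ∪ B) u = A u ∨ B u
  (A ─ B) u = not (B u) ∧ A u
  (A △ B) u = A u xor B u

  ∁ : VertexSet n → VertexSet n
  ∁ A u = not (A u)

  ⁅_⁆ : Fin n → VertexSet n
  ⁅ z ⁆ u = ⌊ u ≟ z ⌋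

crossing : ∀ {n m} → Graph n m → VertexSet n → Fin m → ℕ
crossing G S e = ⟦ S (end G (e , false)) xor S (end G (e , true)) ⟧

-- The list sum over `tabulate` is the vector sum, so that the library's ∑-lemmas apply to cutSize.
listSum-tabulate : ∀ {k} (f : Fin k → ℕ) → listSum (List.tabulate f) ≡ ∑[ i < k ] f i
listSum-tabulate {zero}  f = refl
listSum-tabulate {suc k} f = cong (f fzero +_) (listSum-tabulate (f ∘ fsuc))

cutSize-∑ : ∀ {n m} (G : Graph n m) S → cutSize G S ≡ ∑[ e < m ] crossing G S e
cutSize-∑ G S = trans (cong listSum (map-tabulate id (crossing G S))) (listSum-tabulate (crossing G S))

cutSize-cong : ∀ {n m} (G : Graph n m) {S S′} → (∀ u → S u ≡ S′ u) → cutSize G S ≡ cutSize G S′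
cutSize-cong {m = m} G {S} {S′} S≗S′ = begin
  cutSize G S                   ≡⟨ cutSize-∑ G S ⟩
  ∑[ e < m ] crossing G S e     ≡⟨ sum-cong-≗ (λ e → cong₂ (λ x y → ⟦ x xor y ⟧)
                                     (S≗S′ (end G (e , false))) (S≗S′ (end G (e , true)))) ⟩
  ∑[ e < m ] crossing G S′ e    ≡⟨ cutSize-∑ G S′ ⟨
  cutSize G S′                  ∎
  where open ≡-Reasoning

cutSize-∁ : ∀ {n m} (G : Graph n m) S → cutSize G (∁ S) ≡ cutSize G S
cutSize-∁ {m = m} G S = begin
  cutSize G (∁ S)                ≡⟨ cutSize-∑ G (∁ S) ⟩
  ∑[ e < m ] crossing G (∁ S) e  ≡⟨ sum-cong-≗ (λ e → cong ⟦_⟧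
                                      (xor-annihilates-not (S (end G (e , false))) (S (end G (e , true))))) ⟩
  ∑[ e < m ] crossing G S e      ≡⟨ cutSize-∑ G S ⟨
  cutSize G S                    ∎
  where open ≡-Reasoning

anchor : ∀ {n m} (G : Graph n m) S u → ∃ λ T → T u ≡ true × cutSize G T ≡ cutSize G S
anchor G S u with S u in Su
... | true  = S , Su , refl
... | false = ∁ S , cong not Su , cutSize-∁ G S

cut-parity : ∀ {n m} (G : Graph n m) {A B C} → (∀ u → (A △ B) u ≡ C u)
           → parity (cutSize G A) +ₚ parity (cutSize G B) ≡ parity (cutSize G C)
cut-parity {m = m} G {A} {B} {C} A△B≗C = begin
  parity (cutSize G A) +ₚ parity (cutSize G B)
    ≡⟨ +-homo-+ (cutSize G A) _ ⟨
  parity (cutSize G A + cutSize G B)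
    ≡⟨ cong parity (cong₂ _+_ (cutSize-∑ G A) (cutSize-∑ G B)) ⟩
  parity (∑[ e < m ] crossing G A e + ∑[ e < m ] crossing G B e)
    ≡⟨ cong parity (∑-distrib-+ (crossing G A) (crossing G B)) ⟨
  parity (∑[ e < m ] (crossing G A e + crossing G B e))
    ≡⟨ ∑-parity (λ e → edge (A (x e)) (A (y e)) (B (x e)) (B (y e))) ⟩
  parity (∑[ e < m ] crossing G (A △ B) e)
    ≡⟨ cong parity (cutSize-∑ G (A △ B)) ⟨
  parity (cutSize G (A △ B))
    ≡⟨ cong parity (cutSize-cong G A△B≗C) ⟩
  parity (cutSize G C) ∎
  where
  open ≡-Reasoning
  x y : Fin m → Fin _
  x e = end G (e , false)
  y e = end G (e , true)
  edge : ∀ a a′ b b′ → parity (⟦ a xor a′ ⟧ + ⟦ b xor b′ ⟧) ≡ parity ⟦ (a xor b) xor (a′ xor b′) ⟧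
  edge a a′ b b′ = trans (⟦⟧-parity (a xor a′) (b xor b′)) (cong (parity ∘ ⟦_⟧) (interchange a a′ b b′))

cut-≤-by-edges : ∀ {n m} (G : Graph n m) {A B C D} (h : Fin m → ℕ)
  → (∀ e → crossing G A e + crossing G B e + 2 * h e ≤ crossing G C e + crossing G D e)
  → cutSize G A + cutSize G B + 2 * ∑[ e < m ] h e ≤ cutSize G C + cutSize G D
cut-≤-by-edges {m = m} G {A} {B} {C} {D} h edge = begin
  cutSize G A + cutSize G B + 2 * ∑[ e < m ] h e
    ≡⟨ cong (λ c → c + 2 * ∑[ e < m ] h e)
         (trans (cong₂ _+_ (cutSize-∑ G A) (cutSize-∑ G B)) (sym (∑-distrib-+ (crossing G A) (crossing G B)))) ⟩
  ∑[ e < m ] (crossing G A e + crossing G B e) + 2 * ∑[ e < m ] h e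
    ≡⟨ ∑-double {f = λ e → crossing G A e + crossing G B e} {g = h} (λ _ → refl) ⟩
  ∑[ e < m ] (crossing G A e + crossing G B e + 2 * h e)
    ≤⟨ ∑-mono edge ⟩
  ∑[ e < m ] (crossing G C e + crossing G D e)
    ≡⟨ trans (∑-distrib-+ (crossing G C) (crossing G D)) (sym (cong₂ _+_ (cutSize-∑ G C) (cutSize-∑ G D))) ⟩
  cutSize G C + cutSize G D ∎
  where open ≤-Reasoning

Violation : ∀ {n m} → Graph n m → Set
Violation G = ∃ λ S → Odd (cutSize G S) × cutSize G S < 5

five-odd-connected? : ∀ {n m} (G : Graph n m) → FiveOddConnected G ⊎ Violation G
five-odd-connected? {n} G with anySubset? {n = n} (λ p → odd? (cutSize G (lookup p)) ×-dec (cutSize G (lookup p) <? 5))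
... | yes (p , bad) = inj₂ (lookup p , bad)
... | no none       = inj₁ λ S S-odd → ≮⇒≥ λ S-small →
  none (tabulate S , subst (λ c → Odd c × c < 5) (cutSize-cong G (λ u → sym (lookup∘tabulate S u))) (S-odd , S-small))

five-if-odd : ∀ {n m} {G : Graph n m} → FiveOddConnected G → ∀ S → FiveIfOdd (cutSize G S)
five-if-odd F S = F S ∘ parity⇒Odd

flip : ∀ {m} → Dart m → Dart m
flip (e , s) = e , not s

∑ᴰ : ∀ {m} → (Dart m → ℕ) → ℕ
∑ᴰ {m} g = ∑[ e < m ] (g (e , false) + g (e , true))

∑ᴰ-comm : ∀ {m k} (h : Fin k → Dart m → ℕ) → ∑ᴰ (λ x → ∑[ i < k ] h i x) ≡ ∑[ i < k ] ∑ᴰ (h i)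
∑ᴰ-comm {m} {k} h = begin
  ∑[ e < m ] (∑[ i < k ] h i (e , false) + ∑[ i < k ] h i (e , true))
    ≡⟨ sum-cong-≗ (λ e → sym (∑-distrib-+ (λ i → h i (e , false)) (λ i → h i (e , true)))) ⟩
  ∑[ e < m ] ∑[ i < k ] (h i (e , false) + h i (e , true))
    ≡⟨ ∑-comm (λ e i → h i (e , false) + h i (e , true)) ⟩
  ∑[ i < k ] ∑ᴰ (h i) ∎
  where open ≡-Reasoning

δ : ∀ {m} → Dart m → Dart m → ℕ → ℕ
δ y x c = if ⌊ y ≟D x ⌋ then c else 0

δ-self : ∀ {m} (y : Dart m) c → δ y y c ≡ c
δ-self y c = cong (λ b → if b then c else 0) (⌊⌋-yes (y ≟D y) refl)

δ-other : ∀ {m} (y x : Dart m) c → y ≢ x → δ y x c ≡ 0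
δ-other y x c y≢x = cong (λ b → if b then c else 0) (⌊⌋-no (y ≟D x) y≢x)

∑ᴰ-point : ∀ {m} (y : Dart m) (g : Dart m → ℕ) → ∑ᴰ (λ x → δ y x (g x)) ≡ g y
∑ᴰ-point (e₀ , s₀) g =
  trans (∑-point _ e₀ λ e e≢e₀ → cong₂ _+_ (δ-other _ (e , false) _ (e≢e₀ ∘ sym ∘ cong proj₁))
                                            (δ-other _ (e , true) _ (e≢e₀ ∘ sym ∘ cong proj₁)))
        (at-edge s₀)
  where
  at-edge : ∀ s → δ (e₀ , s) (e₀ , false) (g (e₀ , false)) + δ (e₀ , s) (e₀ , true) (g (e₀ , true))
                ≡ g (e₀ , s)
  at-edge false = trans (cong₂ _+_ (δ-self (e₀ , false) _) (δ-other (e₀ , false) (e₀ , true) _ λ ())) (+-identityʳ _)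
  at-edge true  = cong₂ _+_ (δ-other (e₀ , true) (e₀ , false) _ λ ()) (δ-self (e₀ , true) _)

record Star {n m} (G : Graph n m) (z : Fin n) (k : ℕ) : Set where
  field
    dart      : Fin k → Dart m
    injective : Injective _≡_ _≡_ dart
    at-centre : ∀ i → end G (dart i) ≡ z
    complete  : ∀ x → end G x ≡ z → ∃ λ i → dart i ≡ x

open Star public

∑ᴰ-star : ∀ {n m k} {G : Graph n m} {z} (s : Star G z k) (g : Dart m → ℕ)
        → (∀ x → end G x ≢ z → g x ≡ 0) → ∑ᴰ g ≡ ∑[ i < k ] g (dart s i)
∑ᴰ-star {k = k} {G} {z} s g off = begin
  ∑ᴰ g                                       ≡⟨ sum-cong-≗ (λ e → cong₂ _+_ (expand (e , false))
                                                                       (expand (e , true))) ⟩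
  ∑ᴰ (λ x → ∑[ i < k ] δ (dart s i) x (g x)) ≡⟨ ∑ᴰ-comm (λ i x → δ (dart s i) x (g x)) ⟩
  ∑[ i < k ] ∑ᴰ (λ x → δ (dart s i) x (g x)) ≡⟨ sum-cong-≗ (λ i → ∑ᴰ-point (dart s i) g) ⟩
  ∑[ i < k ] g (dart s i)                   ∎
  where
  open ≡-Reasoning
  expand : ∀ x → g x ≡ ∑[ i < k ] δ (dart s i) x (g x)
  expand x with end G x ≟ z
  ... | no  x-off = trans (off x x-off) (sym (∑-zero λ i → δ-other (dart s i) x (g x) λ dᵢ≡x →
                      x-off (trans (cong (end G) (sym dᵢ≡x)) (at-centre s i))))
  ... | yes x-at with complete s x x-at
  ...   | i₀ , refl = sym (trans (∑-point (λ i → δ (dart s i) x (g x)) i₀ λ i i≢i₀ →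
                                    δ-other (dart s i) x (g x) (i≢i₀ ∘ injective s))
                                 (δ-self x (g x)))

module _ {n m} (G : Graph n m) (a b : Dart m) where

  end-split : ∀ x → end (split G a b) x ≡ (if ⌊ x ≟D a ⌋ ∨ ⌊ x ≟D b ⌋ then fromℕ n else inject₁ (end G x))
  end-split (e , false) = refl
  end-split (e , true)  = refl

  data SplitEnd (x : Dart m) : Set where
    moved : x ≡ a ⊎ x ≡ b → end (split G a b) x ≡ fromℕ n → SplitEnd x
    kept  : x ≢ a → x ≢ b → end (split G a b) x ≡ inject₁ (end G x) → SplitEnd x

  split-end : ∀ x → SplitEnd x
  split-end x with x ≟D a | x ≟D b | end-split x
  ... | yes x≡a | _       | e = moved (inj₁ x≡a) e
  ... | no  _   | yes x≡b | e = moved (inj₂ x≡b) e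
  ... | no  x≢a | no  x≢b | e = kept x≢a x≢b e

  kept-end : ∀ {x} → x ≢ a → x ≢ b → end (split G a b) x ≡ inject₁ (end G x)
  kept-end {x} x≢a x≢b with split-end x
  ... | moved (inj₁ x≡a) _ = ⊥-elim (x≢a x≡a)
  ... | moved (inj₂ x≡b) _ = ⊥-elim (x≢b x≡b)
  ... | kept _ _ e         = e

  module _ {z : Fin n} (a-z : end G a ≡ z) (b-z : end G b ≡ z)
           (Y : VertexSet (suc n)) (Y-merged : Y (fromℕ n) ≡ Y (inject₁ z)) where

    split-merge-end : ∀ x → Y (end (split G a b) x) ≡ Y (inject₁ (end G x))
    split-merge-end x with split-end x
    ... | moved (inj₁ refl) e = trans (cong Y e) (trans Y-merged (cong (Y ∘ inject₁) (sym a-z)))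
    ... | moved (inj₂ refl) e = trans (cong Y e) (trans Y-merged (cong (Y ∘ inject₁) (sym b-z)))
    ... | kept _ _ e          = cong Y e

    cut-split-merge : cutSize (split G a b) Y ≡ cutSize G (Y ∘ inject₁)
    cut-split-merge = begin
      cutSize (split G a b) Y                   ≡⟨ cutSize-∑ (split G a b) Y ⟩
      ∑[ e < m ] crossing (split G a b) Y e     ≡⟨ sum-cong-≗ (λ e → cong₂ (λ p q → ⟦ p xor q ⟧)
                                                     (split-merge-end (e , false)) (split-merge-end (e , true))) ⟩
      ∑[ e < m ] crossing G (Y ∘ inject₁) e     ≡⟨ cutSize-∑ G (Y ∘ inject₁) ⟨
      cutSize G (Y ∘ inject₁)                   ∎
      where open ≡-Reasoning

  star-new : a ≢ b → Star (split G a b) (fromℕ n) 2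
  star-new a≢b = record
    { dart      = pair
    ; injective = pair-injective
    ; at-centre = λ { 0F → moved-end (inj₁ refl) ; 1F → moved-end (inj₂ refl) }
    ; complete  = complete-pair
    }
    where
    pair : Fin 2 → Dart m
    pair 0F = a
    pair 1F = b
    pair-injective : Injective _≡_ _≡_ pair
    pair-injective {0F} {0F} _   = refl
    pair-injective {0F} {1F} a≡b = ⊥-elim (a≢b a≡b)
    pair-injective {1F} {0F} b≡a = ⊥-elim (a≢b (sym b≡a))
    pair-injective {1F} {1F} _   = refl
    moved-end : ∀ {x} → x ≡ a ⊎ x ≡ b → end (split G a b) x ≡ fromℕ n
    moved-end {x} x∈ab with split-end x
    ... | moved _ e       = e
    ... | kept x≢a x≢b _  = ⊥-elim ([ x≢a , x≢b ]′ x∈ab)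
    complete-pair : ∀ x → end (split G a b) x ≡ fromℕ n → ∃ λ i → pair i ≡ x
    complete-pair x x-new with split-end x
    ... | moved (inj₁ x≡a) _ = 0F , sym x≡a
    ... | moved (inj₂ x≡b) _ = 1F , sym x≡b
    ... | kept _ _ e         = ⊥-elim (fromℕ≢inject₁ (trans (sym x-new) e))

star-split : ∀ {n m k l} {G : Graph n m} {z} (s : Star G z k) {i j : Fin k} (σ : Fin l → Fin k)
  → Injective _≡_ _≡_ σ → (∀ r → σ r ≢ i × σ r ≢ j)
  → (∀ t → t ≢ i → t ≢ j → ∃ λ r → σ r ≡ t)
  → Star (split G (dart s i) (dart s j)) (inject₁ z) l
star-split {G = G} {z} s {i} {j} σ σ-injective σ-avoids σ-covers = record
  { dart      = dart s ∘ σ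
  ; injective = σ-injective ∘ injective s
  ; at-centre = λ r → trans (kept-end G a b (proj₁ (avoids r)) (proj₂ (avoids r))) (cong inject₁ (at-centre s (σ r)))
  ; complete  = remaining
  }
  where
  a = dart s i
  b = dart s j
  avoids : ∀ r → dart s (σ r) ≢ a × dart s (σ r) ≢ b
  avoids r = proj₁ (σ-avoids r) ∘ injective s , proj₂ (σ-avoids r) ∘ injective s
  remaining : ∀ x → end (split G a b) x ≡ inject₁ z → ∃ λ r → dart s (σ r) ≡ x
  remaining x x-at with split-end G a b x
  ... | moved _ e = ⊥-elim (fromℕ≢inject₁ (trans (sym e) x-at))
  ... | kept x≢a x≢b e with complete s x (inject₁-injective (trans (sym e) x-at))
  ...   | t , refl with σ-covers t (x≢a ∘ cong (dart s)) (x≢b ∘ cong (dart s))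
  ...     | r , refl = r , refl

-- Edgewise form of the vertex-deletion identity: p, q say whether the ends are z, and x, y whether
-- they lie in X (so p ≤ x and q ≤ y since z ∈ X).
deletion-edge : ∀ {p q x y} → p ≤ᴮ x → q ≤ᴮ y
  → ⟦ (not p ∧ x) xor (not q ∧ y) ⟧ + 2 * (⟦ p ∧ not y ⟧ + ⟦ q ∧ not x ⟧)
    ≡ ⟦ x xor y ⟧ + ⟦ p xor q ⟧
deletion-edge {false} {false}               _   _   = refl
deletion-edge {true}  {false} {y = false}   b≤b _   = refl
deletion-edge {true}  {false} {y = true}    b≤b _   = refl
deletion-edge {false} {true}  {x = false}   _   b≤b = refl
deletion-edge {false} {true}  {x = true}    _   b≤b = refl
deletion-edge {true}  {true}                b≤b b≤b = refl

exits-edge : ∀ {p q x y} → p ≤ᴮ x → q ≤ᴮ y → ⟦ p ∧ not y ⟧ + ⟦ q ∧ not x ⟧ ≤ ⟦ p xor q ⟧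
exits-edge {false} {false}               _   _   = z≤n
exits-edge {true}  {false} {y = false}   b≤b _   = ≤-refl
exits-edge {true}  {false} {y = true}    b≤b _   = z≤n
exits-edge {false} {true}  {x = false}   _   b≤b = ≤-refl
exits-edge {false} {true}  {x = true}    _   b≤b = z≤n
exits-edge {true}  {true}                b≤b b≤b = z≤n

-- Edgewise: the cut of {z} counts the non-loop darts at z, loops contribute two darts each.
loop-edge : ∀ p q → ⟦ p xor q ⟧ + 2 * ⟦ p ∧ q ⟧ ≡ ⟦ p ⟧ + ⟦ q ⟧
loop-edge false q     = +-identityʳ ⟦ q ⟧
loop-edge true  false = refl
loop-edge true  true  = refl

⁅⁆-≤ : ∀ {n} {X : VertexSet n} {z} → X z ≡ true → ∀ u → ⁅ z ⁆ u ≤ᴮ X u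
⁅⁆-≤ {X = X} {z} Xz u with u ≟ z
... | yes refl = subst (true ≤ᴮ_) (sym Xz) b≤b
... | no  _    = ≤-minimum (X u)

module _ {n m k} {G : Graph n m} {z : Fin n} (s : Star G z k) where

  private
    leaving : VertexSet n → Dart m → Bool
    leaving X x = ⁅ z ⁆ (end G x) ∧ not (X (end G (flip x)))

  exitCount : VertexSet n → ℕ
  exitCount X = ∑[ i < k ] ⟦ not (X (end G (flip (dart s i)))) ⟧

  private
    exitCount-∑ᴰ : ∀ X → ∑ᴰ (⟦_⟧ ∘ leaving X) ≡ exitCount X
    exitCount-∑ᴰ X = trans (∑ᴰ-star s (⟦_⟧ ∘ leaving X) off) (sum-cong-≗ on)
      where
      off : ∀ x → end G x ≢ z → ⟦ leaving X x ⟧ ≡ 0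
      off x x-off = cong (λ p → ⟦ p ∧ not (X (end G (flip x))) ⟧) (⌊⌋-no (end G x ≟ z) x-off)
      on : ∀ i → ⟦ leaving X (dart s i) ⟧ ≡ ⟦ not (X (end G (flip (dart s i)))) ⟧
      on i = cong (λ p → ⟦ p ∧ not (X (end G (flip (dart s i)))) ⟧) (⌊⌋-yes (end G (dart s i) ≟ z) (at-centre s i))

  deletion-identity : ∀ X → X z ≡ true
    → cutSize G (X ─ ⁅ z ⁆) + 2 * exitCount X ≡ cutSize G X + cutSize G ⁅ z ⁆
  deletion-identity X Xz = begin
    cutSize G (X ─ ⁅ z ⁆) + 2 * exitCount X
      ≡⟨ cong₂ (λ c E → c + 2 * E) (cutSize-∑ G (X ─ ⁅ z ⁆)) (sym (exitCount-∑ᴰ X)) ⟩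
    ∑[ e < m ] crossing G (X ─ ⁅ z ⁆) e + 2 * ∑ᴰ (⟦_⟧ ∘ leaving X)
      ≡⟨ ∑-double (λ e → deletion-edge (⁅⁆-≤ Xz (end G (e , false))) (⁅⁆-≤ Xz (end G (e , true)))) ⟩
    ∑[ e < m ] (crossing G X e + crossing G ⁅ z ⁆ e)
      ≡⟨ ∑-distrib-+ (crossing G X) (crossing G ⁅ z ⁆) ⟩
    ∑[ e < m ] crossing G X e + ∑[ e < m ] crossing G ⁅ z ⁆ e
      ≡⟨ cong₂ _+_ (cutSize-∑ G X) (cutSize-∑ G ⁅ z ⁆) ⟨
    cutSize G X + cutSize G ⁅ z ⁆ ∎
    where open ≡-Reasoning

  -- Darts leaving X are non-loop darts at z.
  exitCount-≤ : ∀ X → X z ≡ true → exitCount X ≤ cutSize G ⁅ z ⁆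
  exitCount-≤ X Xz = begin
    exitCount X                          ≡⟨ exitCount-∑ᴰ X ⟨
    ∑ᴰ (⟦_⟧ ∘ leaving X)                 ≤⟨ ∑-mono (λ e → exits-edge (⁅⁆-≤ Xz (end G (e , false)))
                                                                 (⁅⁆-≤ Xz (end G (e , true)))) ⟩
    ∑[ e < m ] crossing G ⁅ z ⁆ e        ≡⟨ cutSize-∑ G ⁅ z ⁆ ⟨
    cutSize G ⁅ z ⁆                      ∎
    where open ≤-Reasoning

  -- The degree k is |δ({z})| plus twice the number of loops at z.
  singleton-cut : ∃ λ l → cutSize G ⁅ z ⁆ + 2 * l ≡ k
  singleton-cut = loops , (begin
    cutSize G ⁅ z ⁆ + 2 * loops
      ≡⟨ cong (_+ 2 * loops) (cutSize-∑ G ⁅ z ⁆) ⟩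
    ∑[ e < m ] crossing G ⁅ z ⁆ e + 2 * loops
      ≡⟨ ∑-double (λ e → loop-edge (at (e , false)) (at (e , true))) ⟩
    ∑ᴰ (⟦_⟧ ∘ at)
      ≡⟨ ∑ᴰ-star s (⟦_⟧ ∘ at) (λ x x-off → cong ⟦_⟧ (⌊⌋-no (end G x ≟ z) x-off)) ⟩
    ∑[ i < k ] ⟦ at (dart s i) ⟧
      ≡⟨ sum-cong-≗ (λ i → cong ⟦_⟧ (⌊⌋-yes (end G (dart s i) ≟ z) (at-centre s i))) ⟩
    ∑[ i < k ] 1
      ≡⟨ ∑-ones k ⟩
    k ∎)
    where
    open ≡-Reasoning
    at : Dart m → Bool
    at x = ⁅ z ⁆ (end G x)
    loops : ℕ
    loops = ∑[ e < m ] ⟦ at (e , false) ∧ at (e , true) ⟧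

record Tight {n m} (G : Graph n m) (z : Fin n) (X : VertexSet n) : Set where
  constructor tight
  field
    contains : X z ≡ true
    size     : cutSize G X ≡ 5

record Exits {n m} (G : Graph n m) (X : VertexSet n) (x : Dart m) : Set where
  constructor exit
  field
    outside : X (end G (flip x)) ≡ false

open Exits public

-- A tight set at z left by both a and b; it certifies that splitting off a and b at z fails.
Obstruction : ∀ {n m} → Graph n m → Fin n → Dart m → Dart m → Set
Obstruction G z a b = ∃ λ X → Tight G z X × Exits G X a × Exits G X b

exits-∩ˡ : ∀ {n m} {G : Graph n m} {X Y x} → Exits G X x → Exits G (X ∩ Y) x
exits-∩ˡ (exit X-out) = exit (cong (_∧ _) X-out)

exits-∩ʳ : ∀ {n m} {G : Graph n m} {X Y x} → Exits G Y x → Exits G (X ∩ Y) x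
exits-∩ʳ {X = X} (exit Y-out) = exit (trans (cong (X _ ∧_) Y-out) (∧-zeroʳ _))

-- By the
-- deletion identity |δ(X − z)| + 2·exits = 5 + |δ({z})|; both |δ({z})| and k are even, so X − z has
-- an odd cut, of size at least 5.
exit-bound : ∀ {n m k} {G : Graph n m} {z X} → FiveOddConnected G → (s : Star G z k) → parity k ≡ 0ℙ
  → Tight G z X → 2 * exitCount s X ≤ k
exit-bound {k = k} {G} {z} {X} F s k-even (tight Xz X-cut) = begin
  2 * E   ≤⟨ +-cancelˡ-≤ 5 _ _ (begin
               5 + 2 * E     ≤⟨ +-monoˡ-≤ (2 * E) (five-if-odd {G = G} F (X ─ ⁅ z ⁆) rest-odd) ⟩
               rest + 2 * E  ≡⟨ identity ⟩
               5 + cz        ∎) ⟩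
  cz      ≤⟨ m≤m+n cz (2 * l) ⟩
  cz + 2 * l ≡⟨ deg ⟩
  k ∎
  where
  open ≤-Reasoning
  E = exitCount s X
  rest = cutSize G (X ─ ⁅ z ⁆)
  cz = cutSize G ⁅ z ⁆
  l = proj₁ (singleton-cut s)
  deg : cz + 2 * l ≡ k
  deg = proj₂ (singleton-cut s)
  identity : rest + 2 * E ≡ 5 + cz
  identity = trans (deletion-identity s X Xz) (cong (_+ cz) X-cut)
  cz-even : parity cz ≡ 0ℙ
  cz-even = trans (sym (parity-+2* cz l)) (trans (cong parity deg) k-even)
  rest-odd : parity rest ≡ 1ℙ
  rest-odd = Eq.begin
    parity rest                  Eq.≡⟨ parity-+2* rest E ⟨
    parity (rest + 2 * E)        Eq.≡⟨ cong parity identity ⟩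
    parity (5 + cz)              Eq.≡⟨ +-homo-+ 5 cz ⟩
    1ℙ +ₚ parity cz              Eq.≡⟨ cong (1ℙ +ₚ_) cz-even ⟩
    1ℙ                           Eq.∎
    where module Eq = ≡-Reasoning

too-many-exits : ∀ {n m k} {G : Graph n m} {z X} → FiveOddConnected G → (s : Star G z k) → parity k ≡ 0ℙ
  → Tight G z X → (marked : Fin k → Bool) → (∀ i → T (marked i) → Exits G X (dart s i))
  → k < 2 * ∑[ i < k ] ⟦ marked i ⟧ → ⊥
too-many-exits {G = G} {X = X} F s k-even X-tight marked exits too-many =
  <⇒≱ too-many (≤-trans (*-monoʳ-≤ 2 (∑-mono λ i → ⟦⟧-mono (exit-true i)))
                        (exit-bound {G = G} F s k-even X-tight))
  where
  exit-true : ∀ i → T (marked i) → T (not (X (end G (flip (dart s i)))))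
  exit-true i marked-i rewrite outside (exits i marked-i) = _

submodular-edge : ∀ x y x′ y′
  → ⟦ (x ∧ y) xor (x′ ∧ y′) ⟧ + ⟦ (x ∨ y) xor (x′ ∨ y′) ⟧ + 2 * 0 ≤ ⟦ x xor x′ ⟧ + ⟦ y xor y′ ⟧
submodular-edge = ≤-by-truth-table _ _ _

-- Edgewise posimodularity, |δ(X − Y)| + |δ(Y − X)| ≤ |δ(X)| + |δ(Y)|, with a surplus of 2 on
-- every edge joining X ∩ Y to the complement of X ∪ Y.
posimodular-edge : ∀ x y x′ y′
  → ⟦ (not y ∧ x) xor (not y′ ∧ x′) ⟧ + ⟦ (not x ∧ y) xor (not x′ ∧ y′) ⟧
    + 2 * ⟦ ((x ∧ y) ∧ not (x′ ∨ y′)) ∨ ((x′ ∧ y′) ∧ not (x ∨ y)) ⟧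
  ≤ ⟦ x xor x′ ⟧ + ⟦ y xor y′ ⟧
posimodular-edge = ≤-by-truth-table _ _ _

separates : ∀ {n m} → Graph n m → VertexSet n → VertexSet n → Fin m → Bool
separates G A B e = (A (end G (e , false)) ∧ not (B (end G (e , true))))
                  ∨ (A (end G (e , true)) ∧ not (B (end G (e , false))))

separating-dart : ∀ {n m} (G : Graph n m) A B (x : Dart m)
  → A (end G x) ≡ true → B (end G (flip x)) ≡ false → separates G A B (proj₁ x) ≡ true
separating-dart G A B (e , false) A-x B-x rewrite A-x | B-x = refl
separating-dart G A B (e , true)  A-x B-x rewrite A-x | B-x = ∨-zeroʳ _

∩-△-─ : ∀ x y → (x ∧ y) xor (not y ∧ x) ≡ x
∩-△-─ false y     = ∧-zeroʳ (not y)
∩-△-─ true  false = refl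
∩-△-─ true  true  = refl

∩-△-─′ : ∀ x y → (x ∧ y) xor (not x ∧ y) ≡ y
∩-△-─′ false y = refl
∩-△-─′ true  y = xor-identityʳ y

△-─ : ∀ x y → x xor (not x ∧ y) ≡ x ∨ y
△-─ false y = refl
△-─ true  y = refl

-- With i, u, p, q the cuts of X ∩ Y, X ∪ Y, X − Y, Y − X:
-- if i were even, p and q would be odd, hence ≥ 5, against p + q + 2 ≤ 10; so i is odd, hence
-- q is even and u is odd, and i + u ≤ 10 forces i = 5.
uncross-arithmetic : ∀ {i u p q} → FiveIfOdd i → FiveIfOdd u → FiveIfOdd p → FiveIfOdd q
  → i + u ≤ 10 → p + q + 2 ≤ 10
  → parity i +ₚ parity p ≡ 1ℙ → parity i +ₚ parity q ≡ 1ℙ → 1ℙ +ₚ parity q ≡ parity u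
  → i ≡ 5
uncross-arithmetic {i} {u} {p} {q} five-i five-u five-p five-q iu≤10 pq≤10 ip-odd iq-odd u-parity
  with parity i | parity q
... | 0ℙ | 1ℙ = ⊥-elim (<⇒≱ (≤ᵇ⇒≤ 11 12 _) (≤-trans (+-monoˡ-≤ 2 (+-mono-≤ (five-p ip-odd) (five-q refl))) pq≤10))
... | 1ℙ | 0ℙ = ≤-antisym (+-cancelʳ-≤ u i 5 (≤-trans iu≤10 (+-monoʳ-≤ 5 (five-u (sym u-parity))))) (five-i refl)
uncross-arithmetic _ _ _ _ _ _ _ () _ | 0ℙ | 0ℙ
uncross-arithmetic _ _ _ _ _ _ _ () _ | 1ℙ | 1ℙ

uncross : ∀ {n m} {G : Graph n m} {z X Y} {a : Dart m} → FiveOddConnected G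
  → Tight G z X → Tight G z Y → end G a ≡ z → Exits G X a → Exits G Y a → Tight G z (X ∩ Y)
uncross {m = m} {G} {z} {X} {Y} {a} F (tight Xz X-cut) (tight Yz Y-cut) a-z (exit X-out) (exit Y-out) =
  tight (cong₂ _∧_ Xz Yz) $
  uncross-arithmetic (five (X ∩ Y)) (five (X ∪ Y)) (five (X ─ Y)) (five (Y ─ X)) submodular posimodular
    (trans (cut-parity G {X ∩ Y} {X ─ Y} (λ u → ∩-△-─ (X u) (Y u))) (cong parity X-cut))
    (trans (cut-parity G {X ∩ Y} {Y ─ X} (λ u → ∩-△-─′ (X u) (Y u))) (cong parity Y-cut))
    (trans (cong (λ c → parity c +ₚ parity (cutSize G (Y ─ X))) (sym X-cut))
           (cut-parity G {X} {Y ─ X} (λ u → △-─ (X u) (Y u))))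
  where
  five : ∀ S → FiveIfOdd (cutSize G S)
  five = five-if-odd {G = G} F
  open ≤-Reasoning
  x y x′ y′ : Fin m → Bool
  x e = X (end G (e , false))
  y e = Y (end G (e , false))
  x′ e = X (end G (e , true))
  y′ e = Y (end G (e , true))
  total : cutSize G X + cutSize G Y ≡ 10
  total = cong₂ _+_ X-cut Y-cut
  submodular : cutSize G (X ∩ Y) + cutSize G (X ∪ Y) ≤ 10
  submodular = begin
    cutSize G (X ∩ Y) + cutSize G (X ∪ Y)
      ≤⟨ m≤m+n _ (2 * ∑[ e < m ] 0) ⟩
    cutSize G (X ∩ Y) + cutSize G (X ∪ Y) + 2 * ∑[ e < m ] 0
      ≤⟨ cut-≤-by-edges G {X ∩ Y} {X ∪ Y} {X} {Y} (λ _ → 0) (λ e → submodular-edge (x e) (y e) (x′ e) (y′ e)) ⟩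
    cutSize G X + cutSize G Y
      ≡⟨ total ⟩
    10 ∎
  separated : 1 ≤ ∑[ e < m ] ⟦ separates G (X ∩ Y) (X ∪ Y) e ⟧
  separated = subst (λ b → ⟦ b ⟧ ≤ ∑[ e < m ] ⟦ separates G (X ∩ Y) (X ∪ Y) e ⟧)
                    (separating-dart G (X ∩ Y) (X ∪ Y) a (cong₂ _∧_ (trans (cong X a-z) Xz) (trans (cong Y a-z) Yz))
                                                         (cong₂ _∨_ X-out Y-out))
                    (term-≤-∑ (λ e → ⟦ separates G (X ∩ Y) (X ∪ Y) e ⟧) (proj₁ a))
  posimodular : cutSize G (X ─ Y) + cutSize G (Y ─ X) + 2 ≤ 10
  posimodular = begin
    cutSize G (X ─ Y) + cutSize G (Y ─ X) + 2 * 1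
      ≤⟨ +-monoʳ-≤ (cutSize G (X ─ Y) + cutSize G (Y ─ X)) (*-monoʳ-≤ 2 separated) ⟩
    cutSize G (X ─ Y) + cutSize G (Y ─ X) + 2 * ∑[ e < m ] ⟦ separates G (X ∩ Y) (X ∪ Y) e ⟧
      ≤⟨ cut-≤-by-edges G {X ─ Y} {Y ─ X} {X} {Y} _ (λ e → posimodular-edge (x e) (y e) (x′ e) (y′ e)) ⟩
    cutSize G X + cutSize G Y
      ≡⟨ total ⟩
    10 ∎

-- The counting behind `obstruction`: with c′ the small odd cut in the split graph, c the
-- corresponding cut in G, w the cut of the new vertex and e the number of split darts leaving:
-- c′ + 2e = c + w forces both darts to leave and c = 5.
split-arithmetic : ∀ {c′ c e w} → c′ ≤ 3 → 5 ≤ c → e ≤ w → w ≤ 2 → c′ + 2 * e ≡ c + w → e ≡ 2 × c ≡ 5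
split-arithmetic {c′} {c} {e} {w} c′≤3 5≤c e≤w w≤2 balance = e≡2 , ≤-antisym c≤5 5≤c
  where
  open ≤-Reasoning
  5+e≤3+2e : 3 + (2 + e) ≤ 3 + (e + e)
  5+e≤3+2e = begin
    5 + e        ≤⟨ +-monoʳ-≤ 5 e≤w ⟩
    5 + w        ≤⟨ +-monoˡ-≤ w 5≤c ⟩
    c + w        ≡⟨ balance ⟨
    c′ + 2 * e   ≤⟨ +-monoˡ-≤ (2 * e) c′≤3 ⟩
    3 + 2 * e    ≡⟨ cong (λ t → 3 + (e + t)) (+-identityʳ e) ⟩
    3 + (e + e)  ∎
  e≡2 : e ≡ 2
  e≡2 = ≤-antisym (≤-trans e≤w w≤2) (+-cancelʳ-≤ e 2 e (+-cancelˡ-≤ 3 (2 + e) (e + e) 5+e≤3+2e))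
  c≤5 : c ≤ 5
  c≤5 = +-cancelʳ-≤ w c 5 (begin
    c + w        ≡⟨ balance ⟨
    c′ + 2 * e   ≤⟨ +-monoˡ-≤ (2 * e) c′≤3 ⟩
    3 + 2 * e    ≡⟨ cong (λ t → 3 + 2 * t) e≡2 ⟩
    7            ≤⟨ +-monoʳ-≤ 5 (subst (_≤ w) e≡2 e≤w) ⟩
    5 + w        ∎)

-- Let G′ = G.a z b with new vertex w, and T a side of a small odd cut of G′
-- containing z.  If w ∈ T then T is also a cut of G, which is impossible; otherwise the
-- deletion identity at w, applied to T ∪ {w}, shows that X = T ∩ V(G) is tight and left by a and b.
module _ {n m} {G : Graph n m} {z : Fin n} {a b : Dart m} (F : FiveOddConnected G)
         (a-z : end G a ≡ z) (b-z : end G b ≡ z) (a≢b : a ≢ b) where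

  private
    G′ : Graph (suc n) m
    G′ = split G a b

    w : Fin (suc n)
    w = fromℕ n

    module Anchored (T : VertexSet (suc n)) (Tz : T (inject₁ z) ≡ true)
                    (T-odd : parity (cutSize G′ T) ≡ 1ℙ) (T-small : cutSize G′ T < 5) where

      X : VertexSet n
      X = T ∘ inject₁

      -- The new vertex is not on the side of z: otherwise T would be a small odd cut of G.
      w-outside : T w ≡ false
      w-outside with T w in Tw
      ... | false = refl
      ... | true  = ⊥-elim (<⇒≱ T-small (subst (5 ≤_) (sym T-cut)
                      (five-if-odd {G = G} F X (trans (cong parity (sym T-cut)) T-odd))))
        where
        T-cut : cutSize G′ T ≡ cutSize G X
        T-cut = cut-split-merge G a b a-z b-z T (trans Tw (sym Tz))

      -- T₁ = T ∪ {w} merges the new vertex back into the side of z, and restricts to X on G.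
      T₁ : VertexSet (suc n)
      T₁ = T ∪ ⁅ w ⁆

      T₁-w : T₁ w ≡ true
      T₁-w = trans (cong (T w ∨_) (⌊⌋-yes (w ≟ w) refl)) (∨-zeroʳ (T w))

      T₁-old : ∀ u → T₁ (inject₁ u) ≡ X u
      T₁-old u = trans (cong (X u ∨_) (⌊⌋-no (inject₁ u ≟ w) (fromℕ≢inject₁ ∘ sym))) (∨-identityʳ (X u))

      T₁-merged : T₁ w ≡ T₁ (inject₁ z)
      T₁-merged = trans T₁-w (sym (trans (T₁-old z) Tz))

      T₁-end : ∀ x → T₁ (end G′ x) ≡ X (end G x)
      T₁-end x = trans (split-merge-end G a b a-z b-z T₁ T₁-merged x) (T₁-old (end G x))

      T₁-minus-w : ∀ u → (T₁ ─ ⁅ w ⁆) u ≡ T u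
      T₁-minus-w u with u ≟ w
      ... | yes refl = sym w-outside
      ... | no  _    = ∨-identityʳ (T u)

      s′ : Star G′ w 2
      s′ = star-new G a b a≢b

      E cw l cX : ℕ
      E  = exitCount s′ T₁
      cw = cutSize G′ ⁅ w ⁆
      l  = proj₁ (singleton-cut s′)
      cX = cutSize G X

      balance : cutSize G′ T + 2 * E ≡ cX + cw
      balance = begin
        cutSize G′ T + 2 * E               ≡⟨ cong (_+ 2 * E) (cutSize-cong G′ T₁-minus-w) ⟨
        cutSize G′ (T₁ ─ ⁅ w ⁆) + 2 * E    ≡⟨ deletion-identity s′ T₁ T₁-w ⟩
        cutSize G′ T₁ + cw                 ≡⟨ cong (_+ cw) (trans (cut-split-merge G a b a-z b-z T₁ T₁-merged)
                                                                  (cutSize-cong G T₁-old)) ⟩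
        cX + cw                            ∎
        where open ≡-Reasoning

      -- |δ({w})| is even (w has degree 2), so |δ(X)| has the parity of the odd cut T.
      cw-even : parity cw ≡ 0ℙ
      cw-even = trans (sym (parity-+2* cw l)) (cong parity (proj₂ (singleton-cut s′)))

      X-odd : parity cX ≡ 1ℙ
      X-odd = begin
        parity cX                        ≡⟨ +ₚ-identityʳ (parity cX) ⟨
        parity cX +ₚ 0ℙ                  ≡⟨ cong (parity cX +ₚ_) cw-even ⟨
        parity cX +ₚ parity cw           ≡⟨ +-homo-+ cX cw ⟨
        parity (cX + cw)                 ≡⟨ cong parity balance ⟨
        parity (cutSize G′ T + 2 * E)    ≡⟨ parity-+2* (cutSize G′ T) E ⟩
        parity (cutSize G′ T)            ≡⟨ T-odd ⟩
        1ℙ                               ∎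
        where open ≡-Reasoning

      counted : E ≡ 2 × cX ≡ 5
      counted = split-arithmetic (odd-below-5 T-odd T-small) (five-if-odd {G = G} F X X-odd) (exitCount-≤ s′ T₁ T₁-w)
                  (≤-trans (m≤m+n cw (2 * l)) (≤-reflexive (proj₂ (singleton-cut s′)))) balance

      exit-of : ∀ x → not (T₁ (end G′ (flip x))) ≡ true → Exits G X x
      exit-of x leaves = exit (trans (sym (T₁-end (flip x))) (trans (sym (not-involutive _)) (cong not leaves)))

      result : Obstruction G z a b
      result = X , tight Tz (proj₂ counted) , exit-of a (proj₁ both) , exit-of b (proj₂ both)
        where
        both = both-true (proj₁ counted)

  obstruction : Violation (split G a b) → Obstruction G z a b
  obstruction (S , S-odd , S-small) with anchor G′ S (inject₁ z)
  ... | T , Tz , T-cut =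
    Anchored.result T Tz (trans (cong parity T-cut) (Odd⇒parity S-odd)) (subst (_< 5) (sym T-cut) S-small)

module DegreeEight {n m} (G : Graph n m) (v : Fin n) (d : Fin 8 → Dart m)
  (d-injective : Injective _≡_ _≡_ d) (d-at : ∀ i → end G (d i) ≡ v)
  (d-all : ∀ x → end G x ≡ v → ∃ λ i → d i ≡ x)
  (FH : FiveOddConnected (split G (d 0F) (d 1F))) where

  star₈ : Star G v 8
  star₈ = record { dart = d ; injective = d-injective ; at-centre = d-at ; complete = d-all }

  H : Graph (suc n) m
  H = split G (d 0F) (d 1F)

  -- In H the darts v₃ … v₈ (indices 2 … 7 of d) form the star of v.
  star₆ : Star H (inject₁ v) 6
  star₆ = star-split star₈ (2 ↑ʳ_) (↑ʳ-injective 2 _ _) (λ _ → (λ ()) , (λ ())) cover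
    where
    cover : ∀ t → t ≢ 0F → t ≢ 1F → ∃ λ r → 2 ↑ʳ r ≡ t
    cover 0F               t≢0 _   = ⊥-elim (t≢0 refl)
    cover 1F               _   t≢1 = ⊥-elim (t≢1 refl)
    cover (fsuc (fsuc r))  _   _   = r , refl

  K : Graph (suc (suc n)) m
  K = split H (d 2F) (d 7F)

  -- In K the darts v₄ … v₇ (indices 1 … 4 of star₆) form the star of v.
  star₄ : Star K (inject₁ (inject₁ v)) 4
  star₄ = star-split star₆ (fsuc ∘ inject₁) (inject₁-injective ∘ suc-injective)
                     (λ r → (λ ()) , below-last r) cover
    where
    below-last : ∀ r → fsuc (inject₁ r) ≢ 5F
    below-last r = fromℕ≢inject₁ ∘ sym ∘ suc-injective
    cover : ∀ t → t ≢ 0F → t ≢ 5F → ∃ λ r → fsuc (inject₁ r) ≡ t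
    cover 0F t≢0 _   = ⊥-elim (t≢0 refl)
    cover 1F _   _   = 0F , refl
    cover 2F _   _   = 1F , refl
    cover 3F _   _   = 2F , refl
    cover 4F _   _   = 3F , refl
    cover 5F _   t≢5 = ⊥-elim (t≢5 refl)

  obstruction₆ : ∀ i j → i ≢ j → Violation (split H (dart star₆ i) (dart star₆ j))
               → Obstruction H (inject₁ v) (dart star₆ i) (dart star₆ j)
  obstruction₆ i j i≢j = obstruction FH (at-centre star₆ i) (at-centre star₆ j) (i≢j ∘ injective star₆)

  -- If H.v₃vv₄ and H.v₇vv₈ fail, with tight sets X and Y, then K is 5-odd-connected: a failure of
  -- K gives a tight Z left by v₃ and v₈, and X ∩ Z ∩ Y is tight and left by v₃, v₄, v₇, v₈.
  K-connected : Obstruction H (inject₁ v) (d 2F) (d 3F) → Obstruction H (inject₁ v) (d 6F) (d 7F)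
              → FiveOddConnected K
  K-connected (X , X-tight , X₂ , X₃) (Y , Y-tight , Y₆ , Y₇) S S-odd = ≮⇒≥ λ S-small →
    let (Z , Z-tight , Z₂ , Z₇) = obstruction₆ 0F 5F (λ ()) (S , S-odd , S-small)
        XZ-tight = uncross FH X-tight Z-tight (at-centre star₆ 0F) X₂ Z₂
        W-tight  = uncross FH XZ-tight Y-tight (at-centre star₆ 5F) (exits-∩ʳ Z₇) Y₇
    in too-many-exits FH star₆ refl W-tight (λ { 0F → true ; 1F → true ; 4F → true ; 5F → true ; _ → false })
         (λ { 0F _ → exits-∩ˡ (exits-∩ˡ X₂) ; 1F _ → exits-∩ˡ (exits-∩ˡ X₃) ; 2F () ; 3F ()
            ; 4F _ → exits-∩ʳ Y₆ ; 5F _ → exits-∩ʳ Y₇ })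
         (≤ᵇ⇒≤ 7 8 _)

  -- In K, tight sets left by v₄, v₅ and by v₄, v₆ would meet in one left by v₄, v₅, v₆.
  K-stuck : FiveOddConnected K → Obstruction K (inject₁ (inject₁ v)) (d 3F) (d 4F)
          → Obstruction K (inject₁ (inject₁ v)) (d 3F) (d 5F) → ⊥
  K-stuck FK (Z , Z-tight , Z₃ , Z₄) (Z′ , Z′-tight , Z′₃ , Z′₅) =
    too-many-exits FK star₄ refl (uncross FK Z-tight Z′-tight (at-centre star₄ 0F) Z₃ Z′₃)
      (λ { 0F → true ; 1F → true ; 2F → true ; 3F → false })
      (λ { 0F _ → exits-∩ˡ Z₃ ; 1F _ → exits-∩ˡ Z₄ ; 2F _ → exits-∩ʳ Z′₅ ; 3F () })
      (≤ᵇ⇒≤ 5 6 _)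

  obstruction₄ : ∀ i j → i ≢ j → FiveOddConnected K → Violation (split K (dart star₄ i) (dart star₄ j))
               → Obstruction K (inject₁ (inject₁ v)) (dart star₄ i) (dart star₄ j)
  obstruction₄ i j i≢j FK = obstruction FK (at-centre star₄ i) (at-centre star₄ j) (i≢j ∘ injective star₄)

attempt : ∀ {A V B : Set} → A ⊎ V → (V → B) → A ⊎ B
attempt (inj₁ a) _ = inj₁ a
attempt (inj₂ v) k = inj₂ (k v)

-- Lemma 8.  Unless H.v₃vv₄ or H.v₇vv₈ is 5-odd-connected, K = H.v₃vv₈ is 5-odd-connected, and
-- then K.v₄vv₅ and K.v₄vv₆ cannot both fail.
lemma8 : ∀ {n m} (G : Graph n m) (v : Fin n) (d : Fin 8 → Dart m)
    → Injective _≡_ _≡_ d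
    → (∀ i → end G (d i) ≡ v)
    → (∀ x → end G x ≡ v → ∃ λ i → d i ≡ x)
    → FiveOddConnected G
    → FiveOddConnected (split G (d 0F) (d 1F))
    → FiveOddConnected (split (split G (d 0F) (d 1F)) (d 2F) (d 3F))
      ⊎ (FiveOddConnected (split (split G (d 0F) (d 1F)) (d 6F) (d 7F))
      ⊎ (FiveOddConnected (split (split (split G (d 0F) (d 1F)) (d 2F) (d 7F)) (d 3F) (d 4F))
      ⊎ FiveOddConnected (split (split (split G (d 0F) (d 1F)) (d 2F) (d 7F)) (d 3F) (d 5F))))
lemma8 G v d d-injective d-at d-all _ FH =
  attempt (five-odd-connected? (split H (d 2F) (d 3F))) λ bad₂₃ →
  attempt (five-odd-connected? (split H (d 6F) (d 7F))) λ bad₆₇ →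
  let FK = K-connected (obstruction₆ 0F 1F (λ ()) bad₂₃) (obstruction₆ 4F 5F (λ ()) bad₆₇) in
  attempt (five-odd-connected? (split K (d 3F) (d 4F))) λ bad₃₄ →
  [ id , (λ bad₃₅ → ⊥-elim (K-stuck FK (obstruction₄ 0F 1F (λ ()) FK bad₃₄)
                                       (obstruction₄ 0F 2F (λ ()) FK bad₃₅))) ]′
    (five-odd-connected? (split K (d 3F) (d 5F)))
  where open DegreeEight G v d d-injective d-at d-all FH
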